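{- Let $k$ and $m$ be positive integers and let $G$ be a bipartite graph with $\kappa(G)=k$ and minimum degree $\delta(G)\geq k+\lceil\frac{m}{2}\rceil$. Let $S$ be a minimum vertex-cut of $G$ and let $F$ be a fragment of $G$ to $S$. If there exists a path $P$ of order at most $m$ in $G-(S\cup V(F))$ such that $\kappa(G\langle S\rangle-(V(F)\cup V(P)))\geq k$, then $\kappa(G-V(P))\geq k$.
   Context: All graphs are finite, simple and undirected. The connectivity $\kappa(G)$ is the minimum size of a vertex set $S$ such that $G-S$ is disconnected or has only one vertex. For $S\subseteq V(G)$, $G\langle S\rangle$ denotes the graph $G\cup K(S)$, i.e. $G$ with all edges between pairs of vertices of $S$ added. If $S$ is a minimum vertex-cut of $G$ (a vertex set of size $\kappa(G)$ whose removal disconnects $G$), a fragment of $G$ to $S$ is the union of at least one but not all components of $G-S$. The order of a path is its number of vertices. -}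

module Defs where

open import Data.Nat using (ℕ; suc; _<_; _≤_; _+_; ⌈_/2⌉)
open import Data.Fin using (Fin; _≟_)
open import Data.Fin.Subset using (Subset; _∈_; _∉_; _⊆_; _∪_; _∩_; _─_; ∁; ∣_∣; ⊤; ⊥; ⁅_⁆; Nonempty)
open import Data.Bool using (Bool; true; false; _∨_; _∧_; not)
open import Data.List using (List; []; _∷_; length)
open import Data.List.Relation.Unary.Unique.Propositional using (Unique)
open import Data.Vec using (tabulate)
import Data.Vec
open import Data.Product using (_×_; Σ; ∃)
open import Relation.Nullary using (¬_)
open import Relation.Nullary.Decidable using (⌊_⌋)
open import Relation.Binary.PropositionalEquality using (_≡_)

Adj : ℕ → Set
Adj n = Fin n → Fin n → Bool

record Graph (n : ℕ) : Set where
  field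
    adj    : Adj n
    sym    : ∀ u v → adj u v ≡ adj v u
    irrefl : ∀ v → adj v v ≡ false
open Graph public

data Walk {n : ℕ} (A : Adj n) (W : Subset n) : Fin n → Fin n → Set where
  here : ∀ {u} → u ∈ W → Walk A W u u
  step : ∀ {u w v} → u ∈ W → A u w ≡ true → Walk A W w v → Walk A W u v

Connected : {n : ℕ} → Adj n → Subset n → Set
Connected A W = ∀ u v → u ∈ W → v ∈ W → Walk A W u v

-- κ(H) ≥ k, where H is the graph (Fin n, A) induced on W:
-- for every vertex set X ⊆ V(H) with |X| < k, H - X is connected
-- and has at least two vertices (i.e. is neither disconnected nor trivial).
κ≥ : {n : ℕ} → Adj n → Subset n → ℕ → Set
κ≥ A W k = ∀ X → X ⊆ W → ∣ X ∣ < k → (2 ≤ ∣ W ─ X ∣) × Connected A (W ─ X)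

κ≡ : {n : ℕ} → Adj n → Subset n → ℕ → Set
κ≡ A W k = κ≥ A W k × ¬ κ≥ A W (suc k)

degree : {n : ℕ} → Graph n → Fin n → ℕ
degree G v = ∣ tabulate (adj G v) ∣

MinDegree≥ : {n : ℕ} → Graph n → ℕ → Set
MinDegree≥ G d = ∀ v → d ≤ degree G v

Bipartite : {n : ℕ} → Graph n → Set
Bipartite {n} G = Σ (Fin n → Bool) λ c → ∀ u v → adj G u v ≡ true → ¬ (c u ≡ c v)

-- S is a minimum vertex-cut of G with κ(G) = k.
MinVertexCut : {n : ℕ} → Graph n → ℕ → Subset n → Set
MinVertexCut G k S = (∣ S ∣ ≡ k) × ¬ Connected (adj G) (∁ S)

-- F is a fragment of G to S: a union of at least one but not all components
-- of G - S, i.e. a nonempty proper subset of V(G) - S closed under adjacency in G - S.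
Fragment : {n : ℕ} → Graph n → Subset n → Subset n → Set
Fragment G S F =
  (F ⊆ ∁ S) × Nonempty F × Nonempty (∁ S ─ F) ×
  (∀ u v → u ∈ F → v ∉ S → adj G u v ≡ true → v ∈ F)

-- G⟨S⟩ = G ∪ K(S).
withClique : {n : ℕ} → Graph n → Subset n → Adj n
withClique {n} G S u v = adj G u v ∨ (memb u ∧ memb v ∧ not ⌊ u ≟ v ⌋)
  where
  memb : Fin n → Bool
  memb x = Data.Vec.lookup S x

data IsWalkList {n : ℕ} (A : Adj n) (W : Subset n) : List (Fin n) → Set where
  one  : ∀ {v} → v ∈ W → IsWalkList A W (v ∷ [])
  cons : ∀ {u v vs} → u ∈ W → A u v ≡ true → IsWalkList A W (v ∷ vs) → IsWalkList A W (u ∷ v ∷ vs)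

IsPath : {n : ℕ} → Adj n → Subset n → List (Fin n) → Set
IsPath A W P = IsWalkList A W P × Unique P

verts : {n : ℕ} → List (Fin n) → Subset n
verts []       = ⊥
verts (v ∷ vs) = ⁅ v ⁆ ∪ verts vs

module Submission where

-- Let X, |X| < k, be a vertex set of G − P, and R = V(G) − S − F.  A bipartite graph is
-- triangle-free, so adjacent vertices have disjoint neighbourhoods: if all neighbours of the
-- vertices of Y lie in Y ∪ Z, then either some vertex of Y has all its neighbours in Z, or
-- |Y| + |Z| ≥ 2δ.  Hence |F|, |R| ≥ k + 2⌈m/2⌉, and both F and R meet G − P − X.
-- Suppose G − P − X splits into C₁ ∪ C₂ with a vertex of F in C₁.  If C₂ meets R, then
-- T₁ = (X ∩ (F ∪ S)) ∪ (S ∩ C₁) separates C₁ ∩ F from C₂ in G, and if moreover C₁ ⊈ F then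
-- T₂ = (X − F) ∪ (S ∩ C₂) separates C₂ ∩ R from C₁ − F in G⟨S⟩ − (F ∪ P); so
-- 2k ≤ |T₁| + |T₂| ≤ |X| + |S| < 2k, while C₁ ⊆ F makes T₁ ⊆ X too small.  Up to exchanging
-- C₁ and C₂ the only other case is C₂ ⊆ S.  A vertex y ∈ C₂ then either has a neighbour in C₂,
-- giving 2δ ≤ |C₂| + |X| + |P| < 2k + m, or has all its neighbours in X and on P, where they
-- form an independent set and so number at most ⌈m/2⌉, giving deg y < k + ⌈m/2⌉.

open import Data.Bool using (true; false)
import Data.Bool as Bool
open import Data.Bool.Properties using (∨-identityʳ)
open import Data.Empty using (⊥; ⊥-elim)
open import Data.Fin using (Fin)
open import Data.Fin.Properties using (any?)
open import Data.Fin.Subset hiding (⊥)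
import Data.Fin.Subset as Subset
open import Data.Fin.Subset.Properties
open import Data.List using (List; []; _∷_; length)
open import Data.Nat using (ℕ; zero; suc; _≤_; _<_; _+_; ⌈_/2⌉; ⌊_/2⌋; NonZero; >-nonZero⁻¹; s≤s)
import Data.Nat.Properties as ℕ
open import Data.Nat.Solver using (module +-*-Solver)
open import Data.Product using (_×_; _,_; ∃; Σ; proj₁; proj₂)
open import Data.Sum using (_⊎_; inj₁; inj₂)
import Data.Sum
open import Data.Vec using (_∷_; []; here; there; tabulate; lookup)
open import Data.Vec.Properties using (lookup∘tabulate; lookup⇒[]=; []=⇒lookup)
open import Function using (_∘_; id; flip)
open import Relation.Binary.PropositionalEquality using (_≡_; refl; cong; sym; trans)
open import Relation.Nullary using (¬_; yes; no; ¬?)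
open import Relation.Nullary.Decidable using (_×-dec_; toSum; decidable-stable)

open import Defs hiding (sym)

∣p∣+∣q∣≡∣p∪q∣+∣p∩q∣ : ∀ {n} (p q : Subset n) → ∣ p ∣ + ∣ q ∣ ≡ ∣ p ∪ q ∣ + ∣ p ∩ q ∣
∣p∣+∣q∣≡∣p∪q∣+∣p∩q∣ []            []            = refl
∣p∣+∣q∣≡∣p∪q∣+∣p∩q∣ (true  ∷ p)   (true  ∷ q)   = cong suc (trans (ℕ.+-suc ∣ p ∣ ∣ q ∣)
  (trans (cong suc (∣p∣+∣q∣≡∣p∪q∣+∣p∩q∣ p q)) (sym (ℕ.+-suc ∣ p ∪ q ∣ ∣ p ∩ q ∣))))
∣p∣+∣q∣≡∣p∪q∣+∣p∩q∣ (true  ∷ p)   (false ∷ q)   = cong suc (∣p∣+∣q∣≡∣p∪q∣+∣p∩q∣ p q)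
∣p∣+∣q∣≡∣p∪q∣+∣p∩q∣ (false ∷ p)   (true  ∷ q)   = trans (ℕ.+-suc ∣ p ∣ ∣ q ∣) (cong suc (∣p∣+∣q∣≡∣p∪q∣+∣p∩q∣ p q))
∣p∣+∣q∣≡∣p∪q∣+∣p∩q∣ (false ∷ p)   (false ∷ q)   = ∣p∣+∣q∣≡∣p∪q∣+∣p∩q∣ p q

∣p∪q∣≤∣p∣+∣q∣ : ∀ {n} (p q : Subset n) → ∣ p ∪ q ∣ ≤ ∣ p ∣ + ∣ q ∣
∣p∪q∣≤∣p∣+∣q∣ p q = ℕ.≤-trans (ℕ.m≤m+n ∣ p ∪ q ∣ ∣ p ∩ q ∣) (ℕ.≤-reflexive (sym (∣p∣+∣q∣≡∣p∪q∣+∣p∩q∣ p q)))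

∣p∣+∣q∣≤∣r∣+∣s∣ : ∀ {n} {p q r s : Subset n} → p ∪ q ⊆ r ∪ s → p ∩ q ⊆ r ∩ s → ∣ p ∣ + ∣ q ∣ ≤ ∣ r ∣ + ∣ s ∣
∣p∣+∣q∣≤∣r∣+∣s∣ {p = p} {q} {r} {s} ∪⊆ ∩⊆ = begin
  ∣ p ∣ + ∣ q ∣         ≡⟨ ∣p∣+∣q∣≡∣p∪q∣+∣p∩q∣ p q ⟩
  ∣ p ∪ q ∣ + ∣ p ∩ q ∣ ≤⟨ ℕ.+-mono-≤ (p⊆q⇒∣p∣≤∣q∣ ∪⊆) (p⊆q⇒∣p∣≤∣q∣ ∩⊆) ⟩
  ∣ r ∪ s ∣ + ∣ r ∩ s ∣ ≡⟨ sym (∣p∣+∣q∣≡∣p∪q∣+∣p∩q∣ r s) ⟩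
  ∣ r ∣ + ∣ s ∣         ∎
  where open ℕ.≤-Reasoning

∣⁅x⁆∪p∣≤1+∣p∣ : ∀ {n} (x : Fin n) (p : Subset n) → ∣ ⁅ x ⁆ ∪ p ∣ ≤ suc ∣ p ∣
∣⁅x⁆∪p∣≤1+∣p∣ x p = ℕ.≤-trans (∣p∪q∣≤∣p∣+∣q∣ ⁅ x ⁆ p) (ℕ.≤-reflexive (cong (_+ ∣ p ∣) (∣⁅x⁆∣≡1 x)))

x∈p─q⇒x∉q : ∀ {n} {x : Fin n} (p q : Subset n) → x ∈ p ─ q → x ∉ q
x∈p─q⇒x∉q (true ∷ p)  (false ∷ q) here        ()
x∈p─q⇒x∉q (_    ∷ p)  (_     ∷ q) (there x∈p─q) (there x∈q) = x∈p─q⇒x∉q p q x∈p─q x∈q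

x∈p─q⁻ : ∀ {n} {x : Fin n} (p q : Subset n) → x ∈ p ─ q → x ∈ p × x ∉ q
x∈p─q⁻ p q x∈p─q = p─q⊆p p q x∈p─q , x∈p─q⇒x∉q p q x∈p─q

x∈∁[p∪q]⁻ : ∀ {n} {x : Fin n} (p q : Subset n) → x ∈ ∁ (p ∪ q) → x ∉ p × x ∉ q
x∈∁[p∪q]⁻ p q x∈ = (λ x∈p → x∈∁p⇒x∉p x∈ (x∈p∪q⁺ (inj₁ x∈p)))
                 , (λ x∈q → x∈∁p⇒x∉p x∈ (x∈p∪q⁺ (inj₂ x∈q)))

x∈∁[p∪q]⁺ : ∀ {n} {x : Fin n} {p q : Subset n} → x ∉ p → x ∉ q → x ∈ ∁ (p ∪ q)
x∈∁[p∪q]⁺ {p = p} {q} x∉p x∉q = x∉p⇒x∈∁p λ x∈ → Data.Sum.[ x∉p , x∉q ] (x∈p∪q⁻ p q x∈)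

⊆⊎∃∉ : ∀ {n} (p q : Subset n) → p ⊆ q ⊎ ∃ λ x → x ∈ p × x ∉ q
⊆⊎∃∉ p q with any? (λ x → x ∈? p ×-dec ¬? (x ∈? q))
... | yes witness = inj₂ witness
... | no ∄witness = inj₁ λ {x} x∈p → decidable-stable (x ∈? q) λ x∉q → ∄witness (x , x∈p , x∉q)

∣verts∣≤length : ∀ {n} (vs : List (Fin n)) → ∣ verts vs ∣ ≤ length vs
∣verts∣≤length {n} []       = ℕ.≤-reflexive (∣⊥∣≡0 n)
∣verts∣≤length     (v ∷ vs) = ℕ.≤-trans (∣⁅x⁆∪p∣≤1+∣p∣ v (verts vs)) (s≤s (∣verts∣≤length vs))

verts⊆ : ∀ {n} {A : Adj n} {W vs} → IsWalkList A W vs → verts vs ⊆ W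
verts⊆ {vs = v ∷ _} walk x∈ with x∈p∪q⁻ ⁅ v ⁆ _ x∈ | walk
... | inj₁ x∈⁅v⁆ | one v∈W      rewrite x∈⁅y⁆⇒x≡y v x∈⁅v⁆ = v∈W
... | inj₁ x∈⁅v⁆ | cons v∈W _ _ rewrite x∈⁅y⁆⇒x≡y v x∈⁅v⁆ = v∈W
... | inj₂ x∈⊥   | one _        = ⊥-elim (∉⊥ x∈⊥)
... | inj₂ x∈vs  | cons _ _ rest = verts⊆ rest x∈vs

∈verts-pair⁻ : ∀ {n} {x u v : Fin n} {vs} → x ∈ verts (u ∷ v ∷ vs) → x ≡ u ⊎ x ≡ v ⊎ x ∈ verts vs
∈verts-pair⁻ {u = u} {v} {vs} x∈ with x∈p∪q⁻ ⁅ u ⁆ (verts (v ∷ vs)) x∈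
... | inj₁ x∈⁅u⁆ = inj₁ (x∈⁅y⁆⇒x≡y u x∈⁅u⁆)
... | inj₂ x∈vvs with x∈p∪q⁻ ⁅ v ⁆ (verts vs) x∈vvs
...   | inj₁ x∈⁅v⁆ = inj₂ (inj₁ (x∈⁅y⁆⇒x≡y v x∈⁅v⁆))
...   | inj₂ x∈vs  = inj₂ (inj₂ x∈vs)

Independent : ∀ {n} → Adj n → Subset n → Set
Independent A I = ∀ {x y} → x ∈ I → y ∈ I → ¬ (A x y ≡ true)

verts-pair∩⊆ : ∀ {n} {A : Adj n} {I : Subset n} {u v vs} → Independent A I → A u v ≡ true →
  ∃ λ w → verts (u ∷ v ∷ vs) ∩ I ⊆ ⁅ w ⁆ ∪ verts vs ∩ I
verts-pair∩⊆ {I = I} {u} {v} {vs} indep uv with u ∈? I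
... | yes u∈I = u , λ x∈ → sort (x∈p∩q⁻ (verts (u ∷ v ∷ vs)) I x∈)
  where
  sort : ∀ {x} → x ∈ verts (u ∷ v ∷ vs) × x ∈ I → x ∈ ⁅ u ⁆ ∪ verts vs ∩ I
  sort (x∈ , x∈I) with ∈verts-pair⁻ {u = u} {v} {vs} x∈
  ... | inj₁ refl        = x∈p∪q⁺ {q = verts vs ∩ I} (inj₁ (x∈⁅x⁆ u))
  ... | inj₂ (inj₁ refl) = ⊥-elim (indep u∈I x∈I uv)
  ... | inj₂ (inj₂ x∈vs) = x∈p∪q⁺ {p = ⁅ _ ⁆} {verts vs ∩ I} (inj₂ (x∈p∩q⁺ (x∈vs , x∈I)))
... | no u∉I = v , λ x∈ → sort (x∈p∩q⁻ (verts (u ∷ v ∷ vs)) I x∈)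
  where
  sort : ∀ {x} → x ∈ verts (u ∷ v ∷ vs) × x ∈ I → x ∈ ⁅ v ⁆ ∪ verts vs ∩ I
  sort (x∈ , x∈I) with ∈verts-pair⁻ {u = u} {v} {vs} x∈
  ... | inj₁ refl        = ⊥-elim (u∉I x∈I)
  ... | inj₂ (inj₁ refl) = x∈p∪q⁺ {q = verts vs ∩ I} (inj₁ (x∈⁅x⁆ v))
  ... | inj₂ (inj₂ x∈vs) = x∈p∪q⁺ {p = ⁅ _ ⁆} {verts vs ∩ I} (inj₂ (x∈p∩q⁺ (x∈vs , x∈I)))

∣verts∩I∣≤⌈length/2⌉ : ∀ {n} {A : Adj n} {W I : Subset n} {vs} → Independent A I → IsWalkList A W vs →
  ∣ verts vs ∩ I ∣ ≤ ⌈ length vs /2⌉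
∣verts∩I∣≤⌈length/2⌉ {I = I} {vs = v ∷ []} indep (one _) = ℕ.≤-trans (∣p∩q∣≤∣p∣ (verts (v ∷ [])) I) (∣verts∣≤length (v ∷ []))
∣verts∩I∣≤⌈length/2⌉ {n} {I = I} {vs = u ∷ v ∷ vs} indep (cons _ uv walk) with verts-pair∩⊆ {vs = vs} indep uv
... | w , ⊆w = ℕ.≤-trans (p⊆q⇒∣p∣≤∣q∣ ⊆w) (ℕ.≤-trans (∣⁅x⁆∪p∣≤1+∣p∣ w _) (s≤s (rest walk)))
  where
  rest : ∀ {vs} → IsWalkList _ _ (v ∷ vs) → ∣ verts vs ∩ I ∣ ≤ ⌈ length vs /2⌉
  rest (one _)       = ℕ.≤-trans (∣p∩q∣≤∣p∣ Subset.⊥ I) (ℕ.≤-reflexive (∣⊥∣≡0 n))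
  rest (cons _ _ ws) = ∣verts∩I∣≤⌈length/2⌉ indep ws

neighbours : ∀ {n} → Graph n → Fin n → Subset n
neighbours G v = tabulate (adj G v)

∈neighbours⁻ : ∀ {n} (G : Graph n) {v x} → x ∈ neighbours G v → adj G v x ≡ true
∈neighbours⁻ G {v} {x} x∈ = trans (sym (lookup∘tabulate (adj G v) x)) ([]=⇒lookup x∈)

withClique-outside : ∀ {n} (G : Graph n) {S : Subset n} {x y} → x ∉ S → withClique G S x y ≡ true → adj G x y ≡ true
withClique-outside G {S} {x} {y} x∉S xy with lookup S x in eq
... | true  = ⊥-elim (x∉S (lookup⇒[]= x S eq))
... | false = trans (sym (∨-identityʳ (adj G x y))) xy

TriangleFree : ∀ {n} → Graph n → Set
TriangleFree G = ∀ {x y z} → adj G x y ≡ true → adj G y z ≡ true → ¬ (adj G x z ≡ true)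

Bipartite⇒TriangleFree : ∀ {n} {G : Graph n} → Bipartite G → TriangleFree G
Bipartite⇒TriangleFree {G = G} (colour , proper) {x} {y} {z} xy yz xz
  with colour x | colour y | colour z | proper x y xy | proper y z yz | proper x z xz
... | false | false | _     | c | _ | _ = c refl
... | true  | true  | _     | c | _ | _ = c refl
... | false | true  | false | _ | _ | c = c refl
... | false | true  | true  | _ | c | _ = c refl
... | true  | false | false | _ | c | _ = c refl
... | true  | false | true  | _ | _ | c = c refl

neighbours-independent : ∀ {n} {G : Graph n} → TriangleFree G → ∀ y → Independent (adj G) (neighbours G y)
neighbours-independent {G = G} triangle-free y z∈ z'∈ zz' =
  triangle-free (∈neighbours⁻ G z∈) zz' (∈neighbours⁻ G z'∈)

NeighboursIn : ∀ {n} → Graph n → Subset n → Subset n → Set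
NeighboursIn G Y Q = ∀ {x z} → x ∈ Y → adj G x z ≡ true → z ∈ Q

adjacent⇒d+d≤ : ∀ {n} {G : Graph n} {d y y'} {r s : Subset n} → TriangleFree G → MinDegree≥ G d →
  adj G y y' ≡ true → neighbours G y ∪ neighbours G y' ⊆ r ∪ s → d + d ≤ ∣ r ∣ + ∣ s ∣
adjacent⇒d+d≤ {G = G} {y = y} {y'} triangle-free mindeg yy' ⊆r∪s =
  ℕ.≤-trans (ℕ.+-mono-≤ (mindeg y) (mindeg y')) (∣p∣+∣q∣≤∣r∣+∣s∣ ⊆r∪s common⊆)
  where
  common⊆ : ∀ {r∩s z} → z ∈ neighbours G y ∩ neighbours G y' → z ∈ r∩s
  common⊆ z∈ with x∈p∩q⁻ (neighbours G y) (neighbours G y') z∈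
  ... | yz , y'z = ⊥-elim (triangle-free yy' (∈neighbours⁻ G y'z) (∈neighbours⁻ G yz))

neighbours⊆Z⊎d+d≤∣Y∣+∣Z∣ : ∀ {n} {G : Graph n} {d y} {Y Z : Subset n} → TriangleFree G → MinDegree≥ G d →
  NeighboursIn G Y (Y ∪ Z) → y ∈ Y → neighbours G y ⊆ Z ⊎ d + d ≤ ∣ Y ∣ + ∣ Z ∣
neighbours⊆Z⊎d+d≤∣Y∣+∣Z∣ {G = G} {d} {y} {Y} {Z} triangle-free mindeg closed y∈Y
  with any? (λ y' → y' ∈? Y ×-dec adj G y y' Bool.≟ true)
... | yes (y' , y'∈Y , yy') = inj₂ (adjacent⇒d+d≤ {G = G} {d} triangle-free mindeg yy' both⊆)
  where
  both⊆ : neighbours G y ∪ neighbours G y' ⊆ Y ∪ Z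
  both⊆ z∈ with x∈p∪q⁻ (neighbours G y) (neighbours G y') z∈
  ... | inj₁ z∈Ny  = closed y∈Y  (∈neighbours⁻ G z∈Ny)
  ... | inj₂ z∈Ny' = closed y'∈Y (∈neighbours⁻ G z∈Ny')
... | no ∄y' = inj₁ λ z∈ → outside-Y (x∈p∪q⁻ Y Z (closed y∈Y (∈neighbours⁻ G z∈))) (∈neighbours⁻ G z∈)
  where
  outside-Y : ∀ {z} → z ∈ Y ⊎ z ∈ Z → adj G y z ≡ true → z ∈ Z
  outside-Y (inj₁ z∈Y) yz = ⊥-elim (∄y' (_ , z∈Y , yz))
  outside-Y (inj₂ z∈Z) _  = z∈Z

Closed : ∀ {n} → Adj n → Subset n → Subset n → Set
Closed A W D = ∀ {x y} → x ∈ D → y ∈ W → A x y ≡ true → y ∈ D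

walk-head : ∀ {n} {A : Adj n} {W u v} → Walk A W u v → u ∈ W
walk-head (here u∈W)     = u∈W
walk-head (step u∈W _ _) = u∈W

closed-along-walk : ∀ {n} {A : Adj n} {W D u v} → Closed A W D → Walk A W u v → u ∈ D → v ∈ D
closed-along-walk closed (here _)          u∈D = u∈D
closed-along-walk closed (step _ uw walk) u∈D = closed-along-walk closed walk (closed u∈D (walk-head walk) uw)

κ≥⇒k≤∣separator∣ : ∀ {n} {A : Adj n} {W T D : Subset n} {k a b} → κ≥ A W k → T ⊆ W → Closed A (W ─ T) D →
  a ∈ W ─ T → a ∈ D → b ∈ W ─ T → b ∉ D → k ≤ ∣ T ∣
κ≥⇒k≤∣separator∣ {T = T} κ T⊆W closed a∈ a∈D b∈ b∉D =
  ℕ.≮⇒≥ λ ∣T∣<k → b∉D (closed-along-walk closed (proj₂ (κ T T⊆W ∣T∣<k) _ _ a∈ b∈) a∈D)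

record Separation {n} (A : Adj n) (W : Subset n) : Set where
  field
    C₁ C₂    : Subset n
    C₁⊆W     : C₁ ⊆ W
    C₂⊆W     : C₂ ⊆ W
    cover    : ∀ {x} → x ∈ W → x ∈ C₁ ⊎ x ∈ C₂
    disjoint : ∀ {x} → x ∈ C₁ → ¬ x ∈ C₂
    closed₁  : Closed A W C₁
    closed₂  : Closed A W C₂

swap : ∀ {n} {A : Adj n} {W} → Separation A W → Separation A W
swap sep = record
  { C₁ = C₂ ; C₂ = C₁ ; C₁⊆W = C₂⊆W ; C₂⊆W = C₁⊆W
  ; cover = Data.Sum.swap ∘ cover ; disjoint = flip disjoint
  ; closed₁ = closed₂ ; closed₂ = closed₁ }
  where open Separation sep

module _ {n} (A : Adj n) (A-sym : ∀ x y → A x y ≡ A y x) (W : Subset n) (v : Fin n) where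

  private
    Reaches : Subset n → Set
    Reaches R = ∀ {y} → y ∈ R → Walk A W y v

    closed-or-extensible : ∀ R → Closed A W R ⊎ ∃ λ y → y ∈ W × y ∉ R × ∃ λ x → x ∈ R × A x y ≡ true
    closed-or-extensible R with any? (λ y → y ∈? W ×-dec ¬? (y ∈? R) ×-dec any? (λ x → x ∈? R ×-dec A x y Bool.≟ true))
    ... | yes extension = inj₂ extension
    ... | no ∄extension = inj₁ closed
      where
      closed : Closed A W R
      closed {x} {y} x∈R y∈W xy with y ∈? R
      ... | yes y∈R = y∈R
      ... | no  y∉R = ⊥-elim (∄extension (y , y∈W , y∉R , x , x∈R , xy))

    extend : ∀ {R x y} → Reaches R → y ∈ W → x ∈ R → A x y ≡ true → Reaches (R ∪ ⁅ y ⁆)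
    extend {R} {x} {y} reaches y∈W x∈R xy z∈ with x∈p∪q⁻ R ⁅ y ⁆ z∈
    ... | inj₁ z∈R = reaches z∈R
    ... | inj₂ z∈⁅y⁆ rewrite x∈⁅y⁆⇒x≡y y z∈⁅y⁆ = step y∈W (trans (A-sym y x) xy) (reaches x∈R)

    R⊂R∪⁅y⁆ : ∀ {R : Subset n} {y} → y ∉ R → R ⊂ R ∪ ⁅ y ⁆
    R⊂R∪⁅y⁆ {R} {y} y∉R = p⊆p∪q ⁅ y ⁆ , y , x∈p∪q⁺ (inj₂ (x∈⁅x⁆ y)) , y∉R

    grow : ∀ fuel R → n ≤ fuel + ∣ R ∣ → Reaches R → ∃ λ R' → Reaches R' × R ⊆ R' × Closed A W R'
    grow fuel R bound reaches with closed-or-extensible R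
    ... | inj₁ closed = R , reaches , id , closed
    grow zero R bound reaches | inj₂ (y , _ , y∉R , _) =
      ⊥-elim (ℕ.<-irrefl refl (ℕ.≤-<-trans (ℕ.≤-trans (∣p∣≤n (R ∪ ⁅ y ⁆)) bound) (p⊂q⇒∣p∣<∣q∣ (R⊂R∪⁅y⁆ y∉R))))
    grow (suc fuel) R bound reaches | inj₂ (y , y∈W , y∉R , x , x∈R , xy)
      with grow fuel (R ∪ ⁅ y ⁆) bound′ (extend reaches y∈W x∈R xy)
      where
      bound′ : n ≤ fuel + ∣ R ∪ ⁅ y ⁆ ∣
      bound′ = ℕ.≤-trans bound (ℕ.≤-trans (ℕ.≤-reflexive (sym (ℕ.+-suc fuel ∣ R ∣)))
                 (ℕ.+-monoʳ-≤ fuel (p⊂q⇒∣p∣<∣q∣ (R⊂R∪⁅y⁆ y∉R))))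
    ... | R' , reaches' , R∪⁅y⁆⊆R' , closed = R' , reaches' , R∪⁅y⁆⊆R' ∘ p⊆p∪q ⁅ y ⁆ , closed

  walk-or-separation : ∀ {u} → u ∈ W → v ∈ W →
    Walk A W u v ⊎ Σ (Separation A W) λ sep → v ∈ Separation.C₁ sep × u ∈ Separation.C₂ sep
  walk-or-separation {u} u∈W v∈W with grow n ⁅ v ⁆ (ℕ.m≤m+n n _) here-v
    where
    here-v : Reaches ⁅ v ⁆
    here-v y∈⁅v⁆ rewrite x∈⁅y⁆⇒x≡y v y∈⁅v⁆ = here v∈W
  ... | R , reaches , ⁅v⁆⊆R , closed with u ∈? R
  ...   | yes u∈R = inj₁ (reaches u∈R)
  ...   | no  u∉R = inj₂ (sep , ⁅v⁆⊆R (x∈⁅x⁆ v) , x∈p∧x∉q⇒x∈p─q u∈W u∉R)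
    where
    sep : Separation A W
    sep = record
      { C₁ = R ; C₂ = W ─ R
      ; C₁⊆W = walk-head ∘ reaches ; C₂⊆W = p─q⊆p W R
      ; cover = λ {x} x∈W → Data.Sum.map₂ (x∈p∧x∉q⇒x∈p─q x∈W) (toSum (x ∈? R))
      ; disjoint = λ {x} x∈R x∈W─R → x∈p─q⇒x∉q W R x∈W─R x∈R
      ; closed₁ = closed
      ; closed₂ = λ {x} {y} x∈W─R y∈W xy → x∈p∧x∉q⇒x∈p─q y∈W
                    (λ y∈R → x∈p─q⇒x∉q W R x∈W─R (closed y∈R (p─q⊆p W R x∈W─R) (trans (A-sym y x) xy)))
      }

module Lemma2p3 {n} (G : Graph n) (k m : ℕ) (triangle-free : TriangleFree G)
  (κG : κ≥ (adj G) ⊤ k) (mindeg : MinDegree≥ G (k + ⌈ m /2⌉)) (1≤m : 1 ≤ m)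
  (S F : Subset n) (∣S∣≡k : ∣ S ∣ ≡ k) (F⊆∁S : F ⊆ ∁ S)
  (F-closed : ∀ u v → u ∈ F → v ∉ S → adj G u v ≡ true → v ∈ F)
  {f₀ r₀ : Fin n} (f₀∈F : f₀ ∈ F) (r₀∈R : r₀ ∈ ∁ (S ∪ F))
  (P : List (Fin n)) (P-walk : IsWalkList (adj G) (∁ (S ∪ F)) P) (∣P∣≤m : length P ≤ m)
  (κH : κ≥ (withClique G S) (∁ (F ∪ verts P)) k)
  (X : Subset n) (X⊆∁P : X ⊆ ∁ (verts P)) (∣X∣<k : ∣ X ∣ < k)
  where

  h : ℕ
  h = ⌈ m /2⌉

  -- V-H is the vertex set of G⟨S⟩ − (F ∪ P), and W that of G − P − X.
  R V-H W : Subset n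
  R   = ∁ (S ∪ F)
  V-H = ∁ (F ∪ verts P)
  W   = ∁ (verts P) ─ X

  ∈F⇒∉S : ∀ {x} → x ∈ F → x ∉ S
  ∈F⇒∉S x∈F = x∈∁p⇒x∉p (F⊆∁S x∈F)

  ∈F∪S⇒∉P : ∀ {x} → x ∈ F ∪ S → x ∉ verts P
  ∈F∪S⇒∉P x∈ x∈P = x∈∁p⇒x∉p (verts⊆ P-walk x∈P) (x∈p∪q⁺ (Data.Sum.swap (x∈p∪q⁻ F S x∈)))

  ∈W⁻ : ∀ {x} → x ∈ W → x ∉ verts P × x ∉ X
  ∈W⁻ x∈W with x∈p─q⁻ (∁ (verts P)) X x∈W
  ... | x∈∁P , x∉X = x∈∁p⇒x∉p x∈∁P , x∉X

  ∈W⁺ : ∀ {x} → x ∉ verts P → x ∉ X → x ∈ W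
  ∈W⁺ x∉P x∉X = x∈p∧x∉q⇒x∈p─q (x∉p⇒x∈∁p x∉P) x∉X

  F-neighbours : NeighboursIn G F (F ∪ S)
  F-neighbours {x} {z} x∈F xz with z ∈? S
  ... | yes z∈S = x∈p∪q⁺ (inj₂ z∈S)
  ... | no  z∉S = x∈p∪q⁺ (inj₁ (F-closed x z x∈F z∉S xz))

  R-neighbours : NeighboursIn G R (R ∪ S)
  R-neighbours {x} {z} x∈R xz with z ∈? S | z ∈? F
  ... | yes z∈S | _       = x∈p∪q⁺ (inj₂ z∈S)
  ... | no  z∉S | no z∉F  = x∈p∪q⁺ (inj₁ (x∈∁[p∪q]⁺ z∉S z∉F))
  ... | no  _   | yes z∈F = ⊥-elim (proj₂ (x∈∁[p∪q]⁻ S F x∈R)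
                              (F-closed z x z∈F (proj₁ (x∈∁[p∪q]⁻ S F x∈R)) (trans (Graph.sym G z x) xz)))

  1≤h : 1 ≤ h
  1≤h = ℕ.⌈n/2⌉-mono 1≤m

  m≤h+h : m ≤ h + h
  m≤h+h = begin
    m               ≡⟨ sym (ℕ.⌊n/2⌋+⌈n/2⌉≡n m) ⟩
    ⌊ m /2⌋ + h     ≤⟨ ℕ.+-monoˡ-≤ h (ℕ.⌊n/2⌋≤⌈n/2⌉ m) ⟩
    h + h           ∎
    where open ℕ.≤-Reasoning

  ∣P∣≤h+h : ∣ verts P ∣ ≤ h + h
  ∣P∣≤h+h = ℕ.≤-trans (∣verts∣≤length P) (ℕ.≤-trans ∣P∣≤m m≤h+h)

  δ+δ≡k+[k+[h+h]] : (k + h) + (k + h) ≡ k + (k + (h + h))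
  δ+δ≡k+[k+[h+h]] = solve 2 (λ k h → (k :+ h) :+ (k :+ h) := k :+ (k :+ (h :+ h))) refl k h
    where open +-*-Solver

  k+[h+h]≤∣Y∣ : ∀ {Y y} → NeighboursIn G Y (Y ∪ S) → y ∈ Y → k + (h + h) ≤ ∣ Y ∣
  k+[h+h]≤∣Y∣ {Y} {y} closed y∈Y with neighbours⊆Z⊎d+d≤∣Y∣+∣Z∣ {G = G} {Z = S} triangle-free mindeg closed y∈Y
  ... | inj₁ N⊆S = ⊥-elim (ℕ.≤⇒≯ (ℕ.≤-trans (mindeg y) (ℕ.≤-trans (p⊆q⇒∣p∣≤∣q∣ N⊆S) (ℕ.≤-reflexive ∣S∣≡k)))
                                  (ℕ.m<m+n k 1≤h))
  ... | inj₂ δ+δ≤ = ℕ.+-cancelˡ-≤ k _ _ (begin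
    k + (k + (h + h)) ≡⟨ sym δ+δ≡k+[k+[h+h]] ⟩
    (k + h) + (k + h) ≤⟨ δ+δ≤ ⟩
    ∣ Y ∣ + ∣ S ∣     ≡⟨ cong (∣ Y ∣ +_) ∣S∣≡k ⟩
    ∣ Y ∣ + k         ≡⟨ ℕ.+-comm ∣ Y ∣ k ⟩
    k + ∣ Y ∣         ∎)
    where open ℕ.≤-Reasoning

  F∩W-nonempty : ∃ λ x → x ∈ F × x ∈ W
  F∩W-nonempty with ⊆⊎∃∉ F X
  ... | inj₂ (x , x∈F , x∉X) = x , x∈F , ∈W⁺ (∈F∪S⇒∉P (x∈p∪q⁺ (inj₁ x∈F))) x∉X
  ... | inj₁ F⊆X = ⊥-elim (ℕ.<⇒≱ ∣X∣<k (begin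
    k             ≤⟨ ℕ.m≤m+n k (h + h) ⟩
    k + (h + h)   ≤⟨ k+[h+h]≤∣Y∣ F-neighbours f₀∈F ⟩
    ∣ F ∣         ≤⟨ p⊆q⇒∣p∣≤∣q∣ F⊆X ⟩
    ∣ X ∣         ∎))
    where open ℕ.≤-Reasoning

  R∩W-nonempty : ∃ λ x → x ∈ R × x ∈ W
  R∩W-nonempty with ⊆⊎∃∉ R (X ∪ verts P)
  ... | inj₂ (x , x∈R , x∉X∪P) =
    x , x∈R , ∈W⁺ (λ x∈P → x∉X∪P (x∈p∪q⁺ (inj₂ x∈P))) (λ x∈X → x∉X∪P (x∈p∪q⁺ (inj₁ x∈X)))
  ... | inj₁ R⊆X∪P = ⊥-elim (ℕ.<-irrefl refl (begin-strict
    k + (h + h)           ≤⟨ k+[h+h]≤∣Y∣ R-neighbours r₀∈R ⟩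
    ∣ R ∣                 ≤⟨ p⊆q⇒∣p∣≤∣q∣ R⊆X∪P ⟩
    ∣ X ∪ verts P ∣       ≤⟨ ∣p∪q∣≤∣p∣+∣q∣ X (verts P) ⟩
    ∣ X ∣ + ∣ verts P ∣   <⟨ ℕ.+-mono-<-≤ ∣X∣<k ∣P∣≤h+h ⟩
    k + (h + h)           ∎))
    where open ℕ.≤-Reasoning

  X─F⊆V-H : X ─ F ⊆ V-H
  X─F⊆V-H x∈ with x∈p─q⁻ X F x∈
  ... | x∈X , x∉F = x∈∁[p∪q]⁺ x∉F (x∈∁p⇒x∉p (X⊆∁P x∈X))

  two-vertices : 2 ≤ ∣ W ∣
  two-vertices = ℕ.≤-trans (proj₁ (κH (X ─ F) X─F⊆V-H (ℕ.≤-<-trans (∣p─q∣≤∣p∣ X F) ∣X∣<k)))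
                           (p⊆q⇒∣p∣≤∣q∣ V-H─[X─F]⊆W)
    where
    V-H─[X─F]⊆W : V-H ─ (X ─ F) ⊆ W
    V-H─[X─F]⊆W x∈ with x∈p─q⁻ V-H (X ─ F) x∈
    ... | x∈V-H , x∉X─F with x∈∁[p∪q]⁻ F (verts P) x∈V-H
    ...   | x∉F , x∉P = ∈W⁺ x∉P (λ x∈X → x∉X─F (x∈p∧x∉q⇒x∈p─q x∈X x∉F))

  module _ (sep : Separation (adj G) W) where
    open Separation sep

    T₁ T₂ : Subset n
    T₁ = X ∩ (F ∪ S) ∪ S ∩ C₁
    T₂ = (X ─ F) ∪ S ∩ C₂

    ∈T₁⁻ : ∀ {x} → x ∈ T₁ → (x ∈ X × x ∈ F ∪ S) ⊎ (x ∈ S × x ∈ C₁)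
    ∈T₁⁻ x∈ = Data.Sum.map (x∈p∩q⁻ X (F ∪ S)) (x∈p∩q⁻ S C₁) (x∈p∪q⁻ (X ∩ (F ∪ S)) (S ∩ C₁) x∈)

    ∈T₂⁻ : ∀ {x} → x ∈ T₂ → (x ∈ X × x ∉ F) ⊎ (x ∈ S × x ∈ C₂)
    ∈T₂⁻ x∈ = Data.Sum.map (x∈p─q⁻ X F) (x∈p∩q⁻ S C₂) (x∈p∪q⁻ (X ─ F) (S ∩ C₂) x∈)

    ∈C⇒∉X : ∀ {x} → x ∈ C₁ ⊎ x ∈ C₂ → x ∉ X
    ∈C⇒∉X = proj₂ ∘ ∈W⁻ ∘ Data.Sum.[ C₁⊆W , C₂⊆W ]

    k≤∣T₁∣ : ∀ {a b} → a ∈ C₁ → a ∈ F → b ∈ C₂ → k ≤ ∣ T₁ ∣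
    k≤∣T₁∣ {a} {b} a∈C₁ a∈F b∈C₂ =
      κ≥⇒k≤∣separator∣ κG ⊆⊤ closed (x∈p∧x∉q⇒x∈p─q ∈⊤ a∉T₁) (x∈p∩q⁺ (a∈C₁ , a∈F))
                                    (x∈p∧x∉q⇒x∈p─q ∈⊤ b∉T₁) (λ b∈ → disjoint (proj₁ (x∈p∩q⁻ C₁ F b∈)) b∈C₂)
      where
      a∉T₁ : a ∉ T₁
      a∉T₁ a∈ with ∈T₁⁻ a∈
      ... | inj₁ (a∈X , _) = ∈C⇒∉X (inj₁ a∈C₁) a∈X
      ... | inj₂ (a∈S , _) = ∈F⇒∉S a∈F a∈S
      b∉T₁ : b ∉ T₁
      b∉T₁ b∈ with ∈T₁⁻ b∈
      ... | inj₁ (b∈X , _)  = ∈C⇒∉X (inj₂ b∈C₂) b∈X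
      ... | inj₂ (_ , b∈C₁) = disjoint b∈C₁ b∈C₂
      closed : Closed (adj G) (⊤ ─ T₁) (C₁ ∩ F)
      closed {x} {y} x∈ y∈ xy with x∈p∩q⁻ C₁ F x∈
      ... | x∈C₁ , x∈F = x∈p∩q⁺ (y∈C₁ , y∈F (x∈p∪q⁻ F S y∈F∪S))
        where
        y∉T₁ : y ∉ T₁
        y∉T₁ = x∈p─q⇒x∉q ⊤ T₁ y∈
        y∈F∪S : y ∈ F ∪ S
        y∈F∪S = F-neighbours x∈F xy
        y∈C₁ : y ∈ C₁
        y∈C₁ = closed₁ x∈C₁ (∈W⁺ (∈F∪S⇒∉P y∈F∪S) λ y∈X → y∉T₁ (x∈p∪q⁺ (inj₁ (x∈p∩q⁺ (y∈X , y∈F∪S))))) xy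
        y∈F : y ∈ F ⊎ y ∈ S → y ∈ F
        y∈F (inj₁ y∈F) = y∈F
        y∈F (inj₂ y∈S) = ⊥-elim (y∉T₁ (x∈p∪q⁺ (inj₂ (x∈p∩q⁺ (y∈S , y∈C₁)))))

    k≤∣T₂∣ : ∀ {e b} → e ∈ C₁ → e ∉ F → b ∈ C₂ → b ∈ R → k ≤ ∣ T₂ ∣
    k≤∣T₂∣ {e} {b} e∈C₁ e∉F b∈C₂ b∈R =
      κ≥⇒k≤∣separator∣ κH T₂⊆V-H closed (x∈p∧x∉q⇒x∈p─q b∈V-H b∉T₂) (x∈p∩q⁺ (b∈C₂ , b∈R))
                                    (x∈p∧x∉q⇒x∈p─q e∈V-H e∉T₂) (λ e∈ → disjoint e∈C₁ (proj₁ (x∈p∩q⁻ C₂ R e∈)))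
      where
      T₂⊆V-H : T₂ ⊆ V-H
      T₂⊆V-H x∈ with ∈T₂⁻ x∈
      ... | inj₁ (x∈X , x∉F) = X─F⊆V-H (x∈p∧x∉q⇒x∈p─q x∈X x∉F)
      ... | inj₂ (x∈S , _)   = x∈∁[p∪q]⁺ (λ x∈F → ∈F⇒∉S x∈F x∈S) (∈F∪S⇒∉P (x∈p∪q⁺ (inj₂ x∈S)))
      b∉S : b ∉ S
      b∉S = proj₁ (x∈∁[p∪q]⁻ S F b∈R)
      b∈V-H : b ∈ V-H
      b∈V-H = x∈∁[p∪q]⁺ (proj₂ (x∈∁[p∪q]⁻ S F b∈R)) (proj₁ (∈W⁻ (C₂⊆W b∈C₂)))
      b∉T₂ : b ∉ T₂
      b∉T₂ b∈ with ∈T₂⁻ b∈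
      ... | inj₁ (b∈X , _) = ∈C⇒∉X (inj₂ b∈C₂) b∈X
      ... | inj₂ (b∈S , _) = b∉S b∈S
      e∈V-H : e ∈ V-H
      e∈V-H = x∈∁[p∪q]⁺ e∉F (proj₁ (∈W⁻ (C₁⊆W e∈C₁)))
      e∉T₂ : e ∉ T₂
      e∉T₂ e∈ with ∈T₂⁻ e∈
      ... | inj₁ (e∈X , _)  = ∈C⇒∉X (inj₁ e∈C₁) e∈X
      ... | inj₂ (_ , e∈C₂) = disjoint e∈C₁ e∈C₂
      closed : Closed (withClique G S) (V-H ─ T₂) (C₂ ∩ R)
      closed {x} {y} x∈ y∈ xy with x∈p∩q⁻ C₂ R x∈ | x∈p─q⁻ V-H T₂ y∈
      ... | x∈C₂ , x∈R | y∈V-H , y∉T₂ = x∈p∩q⁺ (y∈C₂ , x∈∁[p∪q]⁺ y∉S y∉F)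
        where
        y∉F : y ∉ F
        y∉F = proj₁ (x∈∁[p∪q]⁻ F (verts P) y∈V-H)
        y∈C₂ : y ∈ C₂
        y∈C₂ = closed₂ x∈C₂ (∈W⁺ (proj₂ (x∈∁[p∪q]⁻ F (verts P) y∈V-H))
                               λ y∈X → y∉T₂ (x∈p∪q⁺ (inj₁ (x∈p∧x∉q⇒x∈p─q y∈X y∉F))))
                       (withClique-outside G (proj₁ (x∈∁[p∪q]⁻ S F x∈R)) xy)
        y∉S : y ∉ S
        y∉S y∈S = y∉T₂ (x∈p∪q⁺ (inj₂ (x∈p∩q⁺ (y∈S , y∈C₂))))

    ∣T₁∣+∣T₂∣≤∣X∣+∣S∣ : ∣ T₁ ∣ + ∣ T₂ ∣ ≤ ∣ X ∣ + ∣ S ∣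
    ∣T₁∣+∣T₂∣≤∣X∣+∣S∣ = ∣p∣+∣q∣≤∣r∣+∣s∣ ∪⊆ ∩⊆
      where
      ∪⊆ : T₁ ∪ T₂ ⊆ X ∪ S
      ∪⊆ x∈ = x∈p∪q⁺ (Data.Sum.[ Data.Sum.map proj₁ proj₁ ∘ ∈T₁⁻ , Data.Sum.map proj₁ proj₁ ∘ ∈T₂⁻ ]
                                  (x∈p∪q⁻ T₁ T₂ x∈))
      ∩⊆ : T₁ ∩ T₂ ⊆ X ∩ S
      ∩⊆ x∈ with x∈p∩q⁻ T₁ T₂ x∈
      ... | x∈T₁ , x∈T₂ with ∈T₁⁻ x∈T₁ | ∈T₂⁻ x∈T₂
      ... | inj₁ (x∈X , x∈F∪S) | inj₁ (_ , x∉F) = x∈p∩q⁺ (x∈X , Data.Sum.[ (λ x∈F → ⊥-elim (x∉F x∈F)) , id ] (x∈p∪q⁻ F S x∈F∪S))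
      ... | inj₁ (x∈X , _)     | inj₂ (x∈S , _) = x∈p∩q⁺ (x∈X , x∈S)
      ... | inj₂ (_ , x∈C₁)    | inj₁ (x∈X , _) = ⊥-elim (∈C⇒∉X (inj₁ x∈C₁) x∈X)
      ... | inj₂ (_ , x∈C₁)    | inj₂ (_ , x∈C₂) = ⊥-elim (disjoint x∈C₁ x∈C₂)

    no-separation-F|R : ∀ {a b} → a ∈ C₁ → a ∈ F → b ∈ C₂ → b ∈ R → ⊥
    no-separation-F|R a∈C₁ a∈F b∈C₂ b∈R with ⊆⊎∃∉ C₁ F
    ... | inj₁ C₁⊆F = ℕ.<⇒≱ ∣X∣<k (ℕ.≤-trans (k≤∣T₁∣ a∈C₁ a∈F b∈C₂) (p⊆q⇒∣p∣≤∣q∣ T₁⊆X))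
      where
      T₁⊆X : T₁ ⊆ X
      T₁⊆X x∈ with ∈T₁⁻ x∈
      ... | inj₁ (x∈X , _)    = x∈X
      ... | inj₂ (x∈S , x∈C₁) = ⊥-elim (∈F⇒∉S (C₁⊆F x∈C₁) x∈S)
    ... | inj₂ (e , e∈C₁ , e∉F) = ℕ.<-irrefl refl (begin-strict
      k + k             ≤⟨ ℕ.+-mono-≤ (k≤∣T₁∣ a∈C₁ a∈F b∈C₂) (k≤∣T₂∣ e∈C₁ e∉F b∈C₂ b∈R) ⟩
      ∣ T₁ ∣ + ∣ T₂ ∣   ≤⟨ ∣T₁∣+∣T₂∣≤∣X∣+∣S∣ ⟩
      ∣ X ∣ + ∣ S ∣     ≡⟨ cong (∣ X ∣ +_) ∣S∣≡k ⟩
      ∣ X ∣ + k         <⟨ ℕ.+-monoˡ-< k ∣X∣<k ⟩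
      k + k             ∎)
      where open ℕ.≤-Reasoning

    no-separation-inside-S : ∀ {b} → C₂ ⊆ S → b ∈ C₂ → ⊥
    no-separation-inside-S {b} C₂⊆S b∈C₂
      with neighbours⊆Z⊎d+d≤∣Y∣+∣Z∣ {G = G} {Z = X ∪ verts P} triangle-free mindeg C₂-neighbours b∈C₂
      where
      C₂-neighbours : NeighboursIn G C₂ (C₂ ∪ X ∪ verts P)
      C₂-neighbours {x} {z} x∈C₂ xz with z ∈? X | z ∈? verts P
      ... | yes z∈X | _       = x∈p∪q⁺ (inj₂ (x∈p∪q⁺ (inj₁ z∈X)))
      ... | no  _   | yes z∈P = x∈p∪q⁺ (inj₂ (x∈p∪q⁺ (inj₂ z∈P)))
      ... | no  z∉X | no  z∉P = x∈p∪q⁺ (inj₁ (closed₂ x∈C₂ (∈W⁺ z∉P z∉X) xz))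
    ... | inj₂ δ+δ≤ = ℕ.<-irrefl refl (begin-strict
      k + (k + (h + h))                 ≡⟨ sym δ+δ≡k+[k+[h+h]] ⟩
      (k + h) + (k + h)                 ≤⟨ δ+δ≤ ⟩
      ∣ C₂ ∣ + ∣ X ∪ verts P ∣          ≤⟨ ℕ.+-mono-≤ ∣C₂∣≤k (∣p∪q∣≤∣p∣+∣q∣ X (verts P)) ⟩
      k + (∣ X ∣ + ∣ verts P ∣)         <⟨ ℕ.+-monoʳ-< k (ℕ.+-mono-<-≤ ∣X∣<k ∣P∣≤h+h) ⟩
      k + (k + (h + h))                 ∎)
      where
      open ℕ.≤-Reasoning
      ∣C₂∣≤k : ∣ C₂ ∣ ≤ k
      ∣C₂∣≤k = ℕ.≤-trans (p⊆q⇒∣p∣≤∣q∣ C₂⊆S) (ℕ.≤-reflexive ∣S∣≡k)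
    ... | inj₁ N⊆X∪P = ℕ.<-irrefl refl (begin-strict
      k + h                               ≤⟨ mindeg b ⟩
      ∣ neighbours G b ∣                  ≤⟨ p⊆q⇒∣p∣≤∣q∣ N⊆X∪[P∩N] ⟩
      ∣ X ∪ verts P ∩ neighbours G b ∣    ≤⟨ ∣p∪q∣≤∣p∣+∣q∣ X _ ⟩
      ∣ X ∣ + ∣ verts P ∩ neighbours G b ∣ <⟨ ℕ.+-mono-<-≤ ∣X∣<k ∣P∩N∣≤h ⟩
      k + h                               ∎)
      where
      open ℕ.≤-Reasoning
      N⊆X∪[P∩N] : neighbours G b ⊆ X ∪ verts P ∩ neighbours G b
      N⊆X∪[P∩N] z∈N with x∈p∪q⁻ X (verts P) (N⊆X∪P z∈N)
      ... | inj₁ z∈X = x∈p∪q⁺ (inj₁ z∈X)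
      ... | inj₂ z∈P = x∈p∪q⁺ (inj₂ (x∈p∩q⁺ (z∈P , z∈N)))
      ∣P∩N∣≤h : ∣ verts P ∩ neighbours G b ∣ ≤ h
      ∣P∩N∣≤h = ℕ.≤-trans (∣verts∩I∣≤⌈length/2⌉ (neighbours-independent {G = G} triangle-free b) P-walk)
                          (ℕ.⌈n/2⌉-mono ∣P∣≤m)

  no-separation : (sep : Separation (adj G) W) → ∀ {a b} →
    a ∈ Separation.C₁ sep → a ∈ F → b ∈ Separation.C₂ sep → ⊥
  no-separation sep a∈C₁ a∈F b∈C₂ with ⊆⊎∃∉ (Separation.C₂ sep) S
  ... | inj₁ C₂⊆S = no-separation-inside-S sep C₂⊆S b∈C₂
  ... | inj₂ (c , c∈C₂ , c∉S) with c ∈? F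
  ...   | no  c∉F = no-separation-F|R sep a∈C₁ a∈F c∈C₂ (x∈∁[p∪q]⁺ c∉S c∉F)
  ...   | yes c∈F with R∩W-nonempty
  ...     | r , r∈R , r∈W with Separation.cover sep r∈W
  ...       | inj₁ r∈C₁ = no-separation-F|R (swap sep) c∈C₂ c∈F r∈C₁ r∈R
  ...       | inj₂ r∈C₂ = no-separation-F|R sep a∈C₁ a∈F r∈C₂ r∈R

  connected : Connected (adj G) W
  connected u v u∈W v∈W with walk-or-separation (adj G) (Graph.sym G) W v u∈W v∈W
  ... | inj₁ walk = walk
  ... | inj₂ (sep , v∈C₁ , u∈C₂) with F∩W-nonempty
  ...   | f , f∈F , f∈W with Separation.cover sep f∈W
  ...     | inj₁ f∈C₁ = ⊥-elim (no-separation sep f∈C₁ f∈F u∈C₂)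
  ...     | inj₂ f∈C₂ = ⊥-elim (no-separation (swap sep) f∈C₂ f∈F v∈C₁)

lemma2p3 : (k m n : ℕ) → .{{NonZero k}} → .{{NonZero m}} → (G : Graph n) →
    Bipartite G → κ≡ (adj G) ⊤ k → MinDegree≥ G (k + ⌈ m /2⌉) →
    (S F : Subset n) → MinVertexCut G k S → Fragment G S F →
    (P : List (Fin n)) → IsPath (adj G) (∁ (S ∪ F)) P → length P ≤ m →
    κ≥ (withClique G S) (∁ (F ∪ verts P)) k →
    κ≥ (adj G) (∁ (verts P)) k
lemma2p3 k m n G bipartite (κG , _) mindeg S F (∣S∣≡k , _) (F⊆∁S , (_ , f₀∈F) , (_ , r₀∈∁S─F) , F-closed)
         P (P-walk , _) ∣P∣≤m κH X X⊆∁P ∣X∣<k = two-vertices , connected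
  where
  r₀∈R : _ ∈ ∁ (S ∪ F)
  r₀∈R = x∈∁[p∪q]⁺ (x∈∁p⇒x∉p (p─q⊆p (∁ S) F r₀∈∁S─F)) (x∈p─q⇒x∉q (∁ S) F r₀∈∁S─F)
  open Lemma2p3 G k m (Bipartite⇒TriangleFree {G = G} bipartite) κG mindeg (>-nonZero⁻¹ m) S F ∣S∣≡k F⊆∁S F-closed
                f₀∈F r₀∈R P P-walk ∣P∣≤m κH X X⊆∁P ∣X∣<k
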